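{- Each sorted modal companion logic $\mathbf{sub.ML}_2$ ($\mathbf{nfl.ML}_2,\mathbf{fl.ML}_2,\mathbf{bci.ML}_2,\mathbf{bck.ML}_2,\mathbf{bcw.ML}_2$) is sound in the corresponding frame class ($\mathbb{NFL},\mathbb{FL},\mathbb{BCI},\mathbb{BCK},\mathbb{BCW}$ respectively).
   Context: Frames $(X,\perp,Y,R)$: $X,Y$ nonempty, $\perp\subseteq X\times Y$ with complement $I$ satisfying: every $x$ has some $y$ with $xIy$ and every $y$ has some $x$ with $xIy$; $R\subseteq X^3$; $x\preceq z$ iff $\forall y(x\perp y\to z\perp y)$. Constraints (C1) $\exists x(xRuv\wedge zRxw)$ iff $\exists x(xRvw\wedge zRux)$; (C2) $xRzz'\leftrightarrow xRz'z$; (C3) $xRzz'\to z'\preceq x$; (C4) $xRxx$. Classes: $\mathbb{NFL}$ all, $\mathbb{FL}$ (C1), $\mathbb{BCI}$ (C1,C2), $\mathbb{BCK}$ (C1–C3), $\mathbb{BCW}$ (C1,C2,C4). Language: sort 1 $\alpha::=P_i\mid\neg\alpha\mid\alpha\wedge\alpha\mid\Box_1\beta\mid\alpha\odot\alpha\mid\alpha\leftharpoonup\alpha\mid\alpha\rightharpoonup\alpha$; sort 2 $\beta::=Q_i\mid\neg\beta\mid\beta\wedge\beta\mid\Box_2\alpha$; $\Diamond_1\beta:=\neg\Box_1\neg\beta$, $\Diamond_2\alpha:=\neg\Box_2\neg\alpha$. Semantics: classical per sort; $x\models\alpha\odot\alpha'$ iff $\exists z,z'(xRzz'\wedge z\models\alpha\wedge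 z'\models\alpha')$; $x\models\alpha\rightharpoonup\alpha'$ iff $\forall z,z'(z\models\alpha\wedge z'Rzx\to z'\models\alpha')$; $x\models\alpha'\leftharpoonup\alpha$ iff $\forall z,z'(z\models\alpha\wedge z'Rxz\to z'\models\alpha')$; $x\models\Box_1\beta$ iff $\forall y(xIy\to y\models\beta)$; $y\models\Box_2\alpha$ iff $\forall x(xIy\to x\models\alpha)$. Proof systems: $\mathbf{ML}_2$ = classical logic per sort plus $\alpha\vdash_1\Box_1\Diamond_2\alpha$, $\Diamond_2\Box_1\beta\vdash_2\beta$, $\Box_1\beta\vdash_1\Diamond_1\beta$, $\Box_2\alpha\vdash_2\Diamond_2\alpha$, $\top\vdash_1\Box_1{\tt t}$, ${\tt t}\vdash_2\Box_2\top$, monotonicity rules for $\Box_1,\Box_2$ and their preservation of $\wedge$. $\mathbf{nfl.ML}_2$ adds monotonicity and residuation for $\odot,\rightharpoonup,\leftharpoonup$ ($\alpha\odot(\alpha\rightharpoonup\alpha')\vdash_1\alpha'$, $\alpha'\vdash_1\alpha\rightharpoonup(\alpha\odot\alpha')$, $\alpha'\vdash_1(\alpha'\odot\alpha)\leftharpoonup\alpha$, $(\alpha'\leftharpoonup\alpha)\odot\alpha\vdash_1\alpha'$); $\mathbf{fl.ML}_2$ adds associativity of $\odot$; $\mathbf{bci.ML}_2$ adds $\alpha\odot\alpha'\vdash_1\alpha'\odot\alpha$; $\mathbf{bcw.ML}_2=\mathbf{bci.ML}_2+\alpha\wedge\alpha'\vdash_1\alpha\odot\alpha'$; $\mathbf{bck.ML}_2=\mathbf{bci.ML}_2+\Box_1\beta\odot\Box_1\beta'\vdash_1\Box_1\beta'$.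 -}

module Defs where

open import Data.Nat using (ℕ; zero)
open import Data.Product using (Σ; ∃; _×_; _,_)
open import Data.Unit using (⊤)
open import Data.Empty using (⊥)
open import Relation.Nullary using (¬_)

infixl 7 _⊙_
infixr 6 _⇀_
infixl 6 _↼_
infixl 5 _∧₁_ _∧₂_

mutual
  data Fm₁ : Set where
    P    : ℕ → Fm₁
    neg₁ : Fm₁ → Fm₁
    _∧₁_ : Fm₁ → Fm₁ → Fm₁
    □₁   : Fm₂ → Fm₁
    _⊙_  : Fm₁ → Fm₁ → Fm₁
    _↼_  : Fm₁ → Fm₁ → Fm₁
    _⇀_  : Fm₁ → Fm₁ → Fm₁

  data Fm₂ : Set where
    Q    : ℕ → Fm₂
    neg₂ : Fm₂ → Fm₂
    _∧₂_ : Fm₂ → Fm₂ → Fm₂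
    □₂   : Fm₁ → Fm₂

◇₁ : Fm₂ → Fm₁
◇₁ β = neg₁ (□₁ (neg₂ β))

◇₂ : Fm₁ → Fm₂
◇₂ α = neg₂ (□₂ (neg₁ α))

⊤₁ : Fm₁
⊤₁ = neg₁ (P zero ∧₁ neg₁ (P zero))

t : Fm₂
t = neg₂ (Q zero ∧₂ neg₂ (Q zero))

record Frame : Set₁ where
  field
    X    : Set
    Y    : Set
    X-ne : X
    Y-ne : Y
    _⊥⊥_ : X → Y → Set
    R    : X → X → X → Set

  I : X → Y → Set
  I x y = ¬ (x ⊥⊥ y)

  _⪯_ : X → X → Set
  x ⪯ z = ∀ y → x ⊥⊥ y → z ⊥⊥ y

  field
    serX : ∀ x → ∃ λ y → I x y
    serY : ∀ y → ∃ λ x → I x y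

module _ (F : Frame) where
  open Frame F

  C1 : Set
  C1 = ∀ u v w z →
         ((∃ λ x → R x u v × R z x w) → (∃ λ x → R x v w × R z u x)) ×
         ((∃ λ x → R x v w × R z u x) → (∃ λ x → R x u v × R z x w))

  C2 : Set
  C2 = ∀ x z z' → (R x z z' → R x z' z) × (R x z' z → R x z z')

  C3 : Set
  C3 = ∀ x z z' → R x z z' → z' ⪯ x

  C4 : Set
  C4 = ∀ x → R x x x

data Logic : Set where
  nfl fl bci bck bcw : Logic

InClass : Logic → Frame → Set
InClass nfl F = ⊤
InClass fl  F = C1 F
InClass bci F = C1 F × C2 F
InClass bck F = C1 F × C2 F × C3 F
InClass bcw F = C1 F × C2 F × C4 F

HasAssoc : Logic → Set
HasAssoc nfl = ⊥
HasAssoc _   = ⊤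

HasComm : Logic → Set
HasComm nfl = ⊥
HasComm fl  = ⊥
HasComm _   = ⊤

HasW : Logic → Set
HasW bcw = ⊤
HasW _   = ⊥

HasK : Logic → Set
HasK bck = ⊤
HasK _   = ⊥

record Valuation (F : Frame) : Set₁ where
  field
    V₁ : ℕ → Frame.X F → Set
    V₂ : ℕ → Frame.Y F → Set

module Sem (F : Frame) (V : Valuation F) where
  open Frame F
  open Valuation V

  mutual
    _⊨₁_ : X → Fm₁ → Set
    x ⊨₁ P i      = V₁ i x
    x ⊨₁ neg₁ α   = ¬ (x ⊨₁ α)
    x ⊨₁ (α ∧₁ β) = (x ⊨₁ α) × (x ⊨₁ β)
    x ⊨₁ □₁ β     = ∀ y → I x y → y ⊨₂ β
    x ⊨₁ (α ⊙ α') = ∃ λ z → ∃ λ z' → R x z z' × (z ⊨₁ α) × (z' ⊨₁ α')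
    x ⊨₁ (α ⇀ α') = ∀ z z' → z ⊨₁ α → R z' z x → z' ⊨₁ α'
    x ⊨₁ (α' ↼ α) = ∀ z z' → z ⊨₁ α → R z' x z → z' ⊨₁ α'

    _⊨₂_ : Y → Fm₂ → Set
    y ⊨₂ Q i      = V₂ i y
    y ⊨₂ neg₂ β   = ¬ (y ⊨₂ β)
    y ⊨₂ (β ∧₂ γ) = (y ⊨₂ β) × (y ⊨₂ γ)
    y ⊨₂ □₂ α     = ∀ x → I x y → x ⊨₁ α

mutual
  data _⊢₁_∶_ (L : Logic) : Fm₁ → Fm₁ → Set where
    id₁   : ∀ {α} → L ⊢₁ α ∶ α
    cut₁  : ∀ {α β γ} → L ⊢₁ α ∶ β → L ⊢₁ β ∶ γ → L ⊢₁ α ∶ γ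
    ∧E₁ˡ  : ∀ {α β} → L ⊢₁ (α ∧₁ β) ∶ α
    ∧E₁ʳ  : ∀ {α β} → L ⊢₁ (α ∧₁ β) ∶ β
    ∧I₁   : ∀ {γ α β} → L ⊢₁ γ ∶ α → L ⊢₁ γ ∶ β → L ⊢₁ γ ∶ (α ∧₁ β)
    exf₁  : ∀ {α β} → L ⊢₁ (α ∧₁ neg₁ α) ∶ β
    negI₁ : ∀ {γ α β} → L ⊢₁ (γ ∧₁ α) ∶ (β ∧₁ neg₁ β) → L ⊢₁ γ ∶ neg₁ α
    dne₁  : ∀ {α} → L ⊢₁ neg₁ (neg₁ α) ∶ α
    unit₁ : ∀ {α} → L ⊢₁ α ∶ □₁ (◇₂ α)
    D₁    : ∀ {β} → L ⊢₁ □₁ β ∶ ◇₁ β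
    top₁  : L ⊢₁ ⊤₁ ∶ □₁ t
    mon□₁ : ∀ {β β'} → L ⊢₂ β ∶ β' → L ⊢₁ □₁ β ∶ □₁ β'
    ∧□₁   : ∀ {β β'} → L ⊢₁ (□₁ β ∧₁ □₁ β') ∶ □₁ (β ∧₂ β')
    mon⊙  : ∀ {α α' β β'} → L ⊢₁ α ∶ α' → L ⊢₁ β ∶ β' → L ⊢₁ (α ⊙ β) ∶ (α' ⊙ β')
    mon⇀  : ∀ {α α' β β'} → L ⊢₁ α' ∶ α → L ⊢₁ β ∶ β' → L ⊢₁ (α ⇀ β) ∶ (α' ⇀ β')
    mon↼  : ∀ {α α' β β'} → L ⊢₁ β ∶ β' → L ⊢₁ α' ∶ α → L ⊢₁ (β ↼ α) ∶ (β' ↼ α')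
    res⇀₁ : ∀ {α α'} → L ⊢₁ (α ⊙ (α ⇀ α')) ∶ α'
    res⇀₂ : ∀ {α α'} → L ⊢₁ α' ∶ (α ⇀ (α ⊙ α'))
    res↼₁ : ∀ {α α'} → L ⊢₁ α' ∶ ((α' ⊙ α) ↼ α)
    res↼₂ : ∀ {α α'} → L ⊢₁ ((α' ↼ α) ⊙ α) ∶ α'
    assoc₁ : ∀ {α β γ} → HasAssoc L → L ⊢₁ ((α ⊙ β) ⊙ γ) ∶ (α ⊙ (β ⊙ γ))
    assoc₂ : ∀ {α β γ} → HasAssoc L → L ⊢₁ (α ⊙ (β ⊙ γ)) ∶ ((α ⊙ β) ⊙ γ)
    comm   : ∀ {α α'} → HasComm L → L ⊢₁ (α ⊙ α') ∶ (α' ⊙ α)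
    axW    : ∀ {α α'} → HasW L → L ⊢₁ (α ∧₁ α') ∶ (α ⊙ α')
    axK    : ∀ {β β'} → HasK L → L ⊢₁ (□₁ β ⊙ □₁ β') ∶ □₁ β'

  data _⊢₂_∶_ (L : Logic) : Fm₂ → Fm₂ → Set where
    id₂   : ∀ {β} → L ⊢₂ β ∶ β
    cut₂  : ∀ {α β γ} → L ⊢₂ α ∶ β → L ⊢₂ β ∶ γ → L ⊢₂ α ∶ γ
    ∧E₂ˡ  : ∀ {α β} → L ⊢₂ (α ∧₂ β) ∶ α
    ∧E₂ʳ  : ∀ {α β} → L ⊢₂ (α ∧₂ β) ∶ β
    ∧I₂   : ∀ {γ α β} → L ⊢₂ γ ∶ α → L ⊢₂ γ ∶ β → L ⊢₂ γ ∶ (α ∧₂ β)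
    exf₂  : ∀ {α β} → L ⊢₂ (α ∧₂ neg₂ α) ∶ β
    negI₂ : ∀ {γ α β} → L ⊢₂ (γ ∧₂ α) ∶ (β ∧₂ neg₂ β) → L ⊢₂ γ ∶ neg₂ α
    dne₂  : ∀ {α} → L ⊢₂ neg₂ (neg₂ α) ∶ α
    counit₂ : ∀ {β} → L ⊢₂ ◇₂ (□₁ β) ∶ β
    D₂    : ∀ {α} → L ⊢₂ □₂ α ∶ ◇₂ α
    top₂  : L ⊢₂ t ∶ □₂ ⊤₁
    mon□₂ : ∀ {α α'} → L ⊢₁ α ∶ α' → L ⊢₂ □₂ α ∶ □₂ α'
    ∧□₂   : ∀ {α α'} → L ⊢₂ (□₂ α ∧₂ □₂ α') ∶ □₂ (α ∧₁ α')

Sound : Logic → Frame → Set₁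
Sound L F = (V : Valuation F) →
  (∀ {α α'} → L ⊢₁ α ∶ α' → ∀ x → Sem._⊨₁_ F V x α → Sem._⊨₁_ F V x α') ×
  (∀ {β β'} → L ⊢₂ β ∶ β' → ∀ y → Sem._⊨₂_ F V y β → Sem._⊨₂_ F V y β')

{-# OPTIONS --safe #-}
module Submission where

open import Defs
open import Level using (0ℓ)
open import Axiom.ExcludedMiddle using (ExcludedMiddle)
open import Axiom.DoubleNegationElimination using (DoubleNegationElimination; em⇒dne)
open import Data.Product using (_,_; proj₁; proj₂)
open import Data.Empty using (⊥-elim)

-- The classical and modal rules hold in every
-- frame (seriality of I gives the D axioms, double negation the counit), residuation is
-- immediate from the clauses for ⊙, ⇀ and ↼, and each structural axiom is valid
-- under its frame condition: C1 reassociates, C2 exchanges, C4 contracts and C3 weakens.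

record Conditions (L : Logic) (F : Frame) : Set where
  field
    associative : HasAssoc L → C1 F
    exchange    : HasComm L → C2 F
    contraction : HasW L → C4 F
    weakening   : HasK L → C3 F

inClass⇒conditions : ∀ L F → InClass L F → Conditions L F
inClass⇒conditions nfl F _              = record
  { associative = λ () ; exchange = λ () ; contraction = λ () ; weakening = λ () }
inClass⇒conditions fl  F c1             = record
  { associative = λ _ → c1 ; exchange = λ () ; contraction = λ () ; weakening = λ () }
inClass⇒conditions bci F (c1 , c2)      = record
  { associative = λ _ → c1 ; exchange = λ _ → c2 ; contraction = λ () ; weakening = λ () }
inClass⇒conditions bck F (c1 , c2 , c3) = record
  { associative = λ _ → c1 ; exchange = λ _ → c2 ; contraction = λ () ; weakening = λ _ → c3 }
inClass⇒conditions bcw F (c1 , c2 , c4) = record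
  { associative = λ _ → c1 ; exchange = λ _ → c2 ; contraction = λ _ → c4 ; weakening = λ () }

module Soundness (dne : DoubleNegationElimination 0ℓ) {F : Frame} (V : Valuation F) where
  open Frame F
  open Sem F V

  ⪯⇒I-antitone : ∀ {x z y} → z ⪯ x → I x y → I z y
  ⪯⇒I-antitone z⪯x ¬x⊥y z⊥y = ¬x⊥y (z⪯x _ z⊥y)

  □₁⇒◇₁ : ∀ {β} x → x ⊨₁ □₁ β → x ⊨₁ ◇₁ β
  □₁⇒◇₁ x x⊨□β x⊨□¬β with serX x
  ... | y , xIy = x⊨□¬β y xIy (x⊨□β y xIy)

  □₂⇒◇₂ : ∀ {α} y → y ⊨₂ □₂ α → y ⊨₂ ◇₂ α
  □₂⇒◇₂ y y⊨□α y⊨□¬α with serY y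
  ... | x , xIy = y⊨□¬α x xIy (y⊨□α x xIy)

  ◇₂□₁-counit : ∀ {β} y → y ⊨₂ ◇₂ (□₁ β) → y ⊨₂ β
  ◇₂□₁-counit y y⊨◇□β = dne λ y⊭β → y⊨◇□β λ x xIy x⊨□β → y⊭β (x⊨□β y xIy)

  ⊙-assocʳ : ∀ {α β γ} → C1 F → ∀ x → x ⊨₁ ((α ⊙ β) ⊙ γ) → x ⊨₁ (α ⊙ (β ⊙ γ))
  ⊙-assocʳ c1 x (u , w , Rxuw , (v , v' , Ruvv' , v⊨α , v'⊨β) , w⊨γ)
    with proj₁ (c1 v v' w x) (u , Ruvv' , Rxuw)
  ... | u' , Ru'v'w , Rxvu' = v , u' , Rxvu' , v⊨α , (v' , w , Ru'v'w , v'⊨β , w⊨γ)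

  ⊙-assocˡ : ∀ {α β γ} → C1 F → ∀ x → x ⊨₁ (α ⊙ (β ⊙ γ)) → x ⊨₁ ((α ⊙ β) ⊙ γ)
  ⊙-assocˡ c1 x (v , u' , Rxvu' , v⊨α , (v' , w , Ru'v'w , v'⊨β , w⊨γ))
    with proj₂ (c1 v v' w x) (u' , Ru'v'w , Rxvu')
  ... | u , Ruvv' , Rxuw = u , w , Rxuw , (v , v' , Ruvv' , v⊨α , v'⊨β) , w⊨γ

  ⊙-comm : ∀ {α β} → C2 F → ∀ x → x ⊨₁ (α ⊙ β) → x ⊨₁ (β ⊙ α)
  ⊙-comm c2 x (z , z' , Rxzz' , z⊨α , z'⊨β) = z' , z , proj₁ (c2 x z z') Rxzz' , z'⊨β , z⊨α

  ∧⇒⊙ : ∀ {α β} → C4 F → ∀ x → x ⊨₁ (α ∧₁ β) → x ⊨₁ (α ⊙ β)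
  ∧⇒⊙ c4 x (x⊨α , x⊨β) = x , x , c4 x , x⊨α , x⊨β

  ⊙□₁-weaken : ∀ {α β} → C3 F → ∀ x → x ⊨₁ (α ⊙ □₁ β) → x ⊨₁ □₁ β
  ⊙□₁-weaken c3 x (z , z' , Rxzz' , _ , z'⊨□β) y xIy =
    z'⊨□β y (⪯⇒I-antitone (c3 x z z' Rxzz') xIy)

  module _ {L : Logic} (cond : Conditions L F) where
    open Conditions cond

    mutual
      sound₁ : ∀ {α α'} → L ⊢₁ α ∶ α' → ∀ x → x ⊨₁ α → x ⊨₁ α'
      sound₁ id₁ x h = h
      sound₁ (cut₁ d e) x h = sound₁ e x (sound₁ d x h)
      sound₁ ∧E₁ˡ x (a , _) = a
      sound₁ ∧E₁ʳ x (_ , b) = b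
      sound₁ (∧I₁ d e) x h = sound₁ d x h , sound₁ e x h
      sound₁ exf₁ x (a , ¬a) = ⊥-elim (¬a a)
      sound₁ (negI₁ d) x h a with sound₁ d x (h , a)
      ... | b , ¬b = ¬b b
      sound₁ dne₁ x h = dne h
      sound₁ unit₁ x h y xIy y⊨□¬α = y⊨□¬α x xIy h
      sound₁ (D₁ {β}) = □₁⇒◇₁ {β}
      sound₁ top₁ x _ y _ (a , ¬a) = ¬a a
      sound₁ (mon□₁ d) x h y xIy = sound₂ d y (h y xIy)
      sound₁ ∧□₁ x (a , b) y xIy = a y xIy , b y xIy
      sound₁ (mon⊙ d e) x (z , z' , r , a , b) = z , z' , r , sound₁ d z a , sound₁ e z' b
      sound₁ (mon⇀ d e) x h z z' a r = sound₁ e z' (h z z' (sound₁ d z a) r)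
      sound₁ (mon↼ d e) x h z z' a r = sound₁ d z' (h z z' (sound₁ e z a) r)
      sound₁ res⇀₁ x (z , z' , r , a , f) = f z x a r
      sound₁ res⇀₂ x h z z' a r = z , x , r , a , h
      sound₁ res↼₁ x h z z' a r = x , z , r , h , a
      sound₁ res↼₂ x (z , z' , r , f , a) = f z' x a r
      sound₁ (assoc₁ {α} {β} {γ} p) = ⊙-assocʳ {α} {β} {γ} (associative p)
      sound₁ (assoc₂ {α} {β} {γ} p) = ⊙-assocˡ {α} {β} {γ} (associative p)
      sound₁ (comm {α} {β} p) = ⊙-comm {α} {β} (exchange p)
      sound₁ (axW {α} {β} p) = ∧⇒⊙ {α} {β} (contraction p)
      sound₁ (axK {β} {β'} p) = ⊙□₁-weaken {□₁ β} {β'} (weakening p)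

      sound₂ : ∀ {β β'} → L ⊢₂ β ∶ β' → ∀ y → y ⊨₂ β → y ⊨₂ β'
      sound₂ id₂ y h = h
      sound₂ (cut₂ d e) y h = sound₂ e y (sound₂ d y h)
      sound₂ ∧E₂ˡ y (a , _) = a
      sound₂ ∧E₂ʳ y (_ , b) = b
      sound₂ (∧I₂ d e) y h = sound₂ d y h , sound₂ e y h
      sound₂ exf₂ y (a , ¬a) = ⊥-elim (¬a a)
      sound₂ (negI₂ d) y h a with sound₂ d y (h , a)
      ... | b , ¬b = ¬b b
      sound₂ dne₂ y h = dne h
      sound₂ (counit₂ {β}) = ◇₂□₁-counit {β}
      sound₂ (D₂ {α}) = □₂⇒◇₂ {α}
      sound₂ top₂ y _ x _ (a , ¬a) = ¬a a
      sound₂ (mon□₂ d) y h x xIy = sound₁ d x (h x xIy)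
      sound₂ ∧□₂ y (a , b) x xIy = a x xIy , b x xIy

theorem3p4 : ExcludedMiddle 0ℓ → (L : Logic) (F : Frame) → InClass L F → Sound L F
theorem3p4 em L F inClass V = sound₁ conditions , sound₂ conditions
  where
  open Soundness (em⇒dne em) V
  conditions : Conditions L F
  conditions = inClass⇒conditions L F inClass
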